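{- Let $G=(V,E)$ be an undirected transitively orientable graph and $\overline{G}$ its complement. Then (i) for every orientation $H$ of $\overline{G}$, the graph $G\setminus\mathcal{U}(H^*)$ (on $V$, with edge set $E\setminus(E_H^*\cup(E_H^*)^{ -1})$ where $E_H^*$ is the edge set of the transitive closure $H^*$ of $H$) is a permutation subgraph of $G$; and (ii) every locally maximal permutation subgraph $P$ of $G$ is of the form $P=G\setminus\mathcal{U}(H^*)$ for some orientation $H$ of $\overline{G}$.
   Context: All graphs are simple and directed; an undirected edge is represented as a pair of opposite directed edges, and a graph is undirected if $E=E^{ -1}$, where $E^{ -1}=\{(b,a)\mid (a,b)\in E\}$. $\mathcal{U}(G)=(V,E\cup E^{ -1})$, and the complement of $G$ is $(V,\{(a,b)\mid a,b\in V,\ a\neq b\}\setminus (E\cup E^{ -1}))$. A graph is transitive if $(a,b),(b,c)\in E$ with $a\neq c$ implies $(a,c)\in E$; the transitive closure has as edge set the minimal transitive superset of the edge set. A graph $(V,E)$ is oriented if $E\cap E^{ -1}=\emptyset$; $(V,E')$ is an orientation of $(V,E)$ if $E'$ is a maximal oriented subset of $E$; a graph is transitively orientable if it has an orientation that is transitive. An undirected graph is a permutation graph iff both it and its complement are transitively orientable. Subgraphs of $G$ are graphs $(V,E')$ with $E'\subseteq E$. A permutation subgraph $P$ of $G$ is locally maximal if no permutation subgraph of $G$ has edge set strictly containing that of $P$. -}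

module Defs where

open import Data.Bool using (Bool; true; false; not; _∧_; _∨_)
open import Data.Fin using (Fin; _≟_)
open import Data.Nat using (ℕ)
open import Data.Product using (Σ; _×_)
open import Data.Sum using (_⊎_)
open import Data.Empty using (⊥)
open import Relation.Nullary using (¬_)
open import Relation.Nullary.Decidable using (⌊_⌋)
open import Relation.Binary.PropositionalEquality using (_≡_; _≢_)

-- A (finite) graph on vertex set V = Fin n is given by its edge set,
-- represented as a Boolean adjacency relation: (a , b) ∈ E  iff  E a b ≡ true.
EdgeSet : ℕ → Set
EdgeSet n = Fin n → Fin n → Bool

module _ {n : ℕ} where

  Edge : EdgeSet n → Fin n → Fin n → Set
  Edge E a b = E a b ≡ true

  Loopless : EdgeSet n → Set
  Loopless E = ∀ a → E a a ≡ false

  _⊆_ : EdgeSet n → EdgeSet n → Set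
  E ⊆ F = ∀ a b → Edge E a b → Edge F a b

  inverse : EdgeSet n → EdgeSet n
  inverse E a b = E b a

  Undirected : EdgeSet n → Set
  Undirected E = ∀ a b → E a b ≡ inverse E a b

  Oriented : EdgeSet n → Set
  Oriented E = ∀ a b → Edge E a b → Edge (inverse E) a b → ⊥

  IsOrientation : EdgeSet n → EdgeSet n → Set
  IsOrientation E' E =
    (E' ⊆ E) × Oriented E' ×
    (∀ E'' → E' ⊆ E'' → E'' ⊆ E → Oriented E'' → E'' ⊆ E')

  Transitive : EdgeSet n → Set
  Transitive E = ∀ a b c → Edge E a b → Edge E b c → a ≢ c → Edge E a c

  TransitivelyOrientable : EdgeSet n → Set
  TransitivelyOrientable E = Σ (EdgeSet n) λ E' → IsOrientation E' E × Transitive E'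

  complement : EdgeSet n → EdgeSet n
  complement E a b = not ⌊ a ≟ b ⌋ ∧ not (E a b ∨ E b a)

  -- an undirected graph is a permutation graph iff it and its complement
  -- are transitively orientable
  IsPermutationGraph : EdgeSet n → Set
  IsPermutationGraph E =
    Undirected E × TransitivelyOrientable E × TransitivelyOrientable (complement E)

  PermutationSubgraph : EdgeSet n → EdgeSet n → Set
  PermutationSubgraph P G = (P ⊆ G) × IsPermutationGraph P

  LocallyMaximal : EdgeSet n → EdgeSet n → Set
  LocallyMaximal P G =
    PermutationSubgraph P G ×
    (∀ Q → PermutationSubgraph Q G → P ⊆ Q → Q ⊆ P)

  -- edge set of the transitive closure H* : the minimal transitive superset of E_H
  -- (transitivity only demanded for a ≠ c, as in the definition of transitive)
  data Closure (H : EdgeSet n) : Fin n → Fin n → Set where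
    base : ∀ {a b} → Edge H a b → Closure H a b
    step : ∀ {a b c} → Closure H a b → Closure H b c → a ≢ c → Closure H a c

  RemovedEdge : EdgeSet n → EdgeSet n → Fin n → Fin n → Set
  RemovedEdge G H a b = Edge G a b × ¬ (Closure H a b ⊎ Closure H b a)

  IsRemoval : EdgeSet n → EdgeSet n → EdgeSet n → Set
  IsRemoval P G H =
    ∀ a b → (Edge P a b → RemovedEdge G H a b) × (RemovedEdge G H a b → Edge P a b)

module Submission where

-- Corollary 14.  Let T be a transitive orientation of the loopless undirected
-- graph G and H* the transitive closure of an orientation H of Ḡ.
-- (i)  P = G ∖ 𝒰(H*) is a permutation subgraph: T ∩ P orients P transitively,
--      because for a → b → c in T with ab, bc ∈ P neither a ⇝ c nor c ⇝ a lies
--      in H* (no-shortcut: follow an H-walk, keeping each vertex T-below b);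
--      and P̄ = 𝒰(H*) is oriented transitively by breaking ties between
--      opposite H*-edges with the vertex order (tieBreak-orientation).
-- (ii) For P₀ locally maximal with C a transitive orientation of P̄₀, the
--      orientation H = C ∩ Ḡ has H* ⊆ C, so P₀ ⊆ G ∖ 𝒰(H*); maximality and (i)
--      give equality.

open import Defs
open import Data.Bool using (true; false; not; _∧_; _∨_)
import Data.Bool as Bool
open import Data.Bool.Properties using (∨-comm; ∧-conicalˡ; ∧-conicalʳ)
open import Data.Empty using (⊥; ⊥-elim)
open import Data.Fin using (Fin; _≟_; _<_)
open import Data.Fin.Properties using (any?; pigeonhole; <-cmp; <-asym; <-trans; _<?_; <⇒≢)
open import Data.Nat using (ℕ; zero; suc; _+_; s≤s) renaming (_≤_ to _≤ℕ_; _<_ to _<ℕ_)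
open import Data.Nat.Induction using (<-rec)
open import Data.Nat.Properties using (≮⇒≥; ≤-refl; m≤n⇒m≤1+n; anyUpTo?)
open import Data.Product using (Σ; ∃; _×_; _,_; proj₁; proj₂)
open import Data.Sum using (_⊎_; inj₁; inj₂; [_,_]′) renaming (swap to ⊎-swap; map to ⊎-map)
open import Data.Vec using (Vec; []; _∷_; lookup)
open import Data.Vec.Membership.Propositional using (_∈_)
open import Data.Vec.Relation.Unary.Any using (here; there)
open import Data.Vec.Relation.Unary.All using (All; []; _∷_)
import Data.Vec.Membership.DecPropositional as DecMembership
open import Data.Vec.Relation.Unary.AllPairs using ([]; _∷_)
open import Data.Vec.Relation.Unary.Unique.Propositional using (Unique)
open import Data.Vec.Relation.Unary.Unique.Propositional.Properties using (lookup-injective)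
open import Relation.Binary using (tri<; tri≈; tri>)
open import Relation.Binary.PropositionalEquality using (_≡_; _≢_; refl; sym; trans; cong; cong₂)
open import Relation.Nullary using (¬_; Dec; yes; no)
open import Relation.Nullary.Decidable using (⌊_⌋; map′; _×-dec_)

∧-intro : ∀ {x y} → x ≡ true → y ≡ true → x ∧ y ≡ true
∧-intro refl refl = refl

∨-introˡ : ∀ {x} y → x ≡ true → x ∨ y ≡ true
∨-introˡ _ refl = refl

∨-introʳ : ∀ x {y} → y ≡ true → x ∨ y ≡ true
∨-introʳ true  _    = refl
∨-introʳ false refl = refl

∨-elim : ∀ x {y} → x ∨ y ≡ true → x ≡ true ⊎ y ≡ true
∨-elim true  _ = inj₁ refl
∨-elim false e = inj₂ e

not-intro : ∀ {x} → ¬ x ≡ true → not x ≡ true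
not-intro {true}  ¬x = ⊥-elim (¬x refl)
not-intro {false} _  = refl

not-elim : ∀ {x} → not x ≡ true → ¬ x ≡ true
not-elim {true} ()

⌊⌋-intro : ∀ {A : Set} (d : Dec A) → A → ⌊ d ⌋ ≡ true
⌊⌋-intro (yes _) _ = refl
⌊⌋-intro (no ¬a) a = ⊥-elim (¬a a)

⌊⌋-elim : ∀ {A : Set} (d : Dec A) → ⌊ d ⌋ ≡ true → A
⌊⌋-elim (yes a) _ = a

unique-length : ∀ {n m} (xs : Vec (Fin n) m) → Unique xs → m ≤ℕ n
unique-length xs distinct = ≮⇒≥ λ n<m →
  let (i , j , i<j , same) = pigeonhole n<m (lookup xs)
  in <⇒≢ i<j (lookup-injective distinct i j same)

∉⇒All≢ : ∀ {A : Set} {m} {x : A} (xs : Vec A m) → ¬ x ∈ xs → All (x ≢_) xs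
∉⇒All≢ []       _   = []
∉⇒All≢ (y ∷ ys) x∉ = (λ x≡y → x∉ (here x≡y)) ∷ ∉⇒All≢ ys (λ x∈ys → x∉ (there x∈ys))

module _ {n : ℕ} where

  Irreflexive : EdgeSet n → Set
  Irreflexive E = ∀ a → ¬ Edge E a a

  Symmetric : EdgeSet n → Set
  Symmetric E = ∀ {a b} → Edge E a b → Edge E b a

  Covers : EdgeSet n → EdgeSet n → Set
  Covers O E = ∀ {a b} → Edge E a b → Edge O a b ⊎ Edge O b a

  _∩_ : EdgeSet n → EdgeSet n → EdgeSet n
  (E ∩ F) a b = E a b ∧ F a b

  _∪_ : EdgeSet n → EdgeSet n → EdgeSet n
  (E ∪ F) a b = E a b ∨ F a b

  single : Fin n → Fin n → EdgeSet n
  single a b x y = ⌊ x ≟ a ⌋ ∧ ⌊ y ≟ b ⌋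

  edge? : (E : EdgeSet n) → ∀ a b → Dec (Edge E a b)
  edge? E a b = E a b Bool.≟ true

  ∩-intro : ∀ {E F a b} → Edge E a b → Edge F a b → Edge (E ∩ F) a b
  ∩-intro = ∧-intro

  ∩-elim : ∀ {E F a b} → Edge (E ∩ F) a b → Edge E a b × Edge F a b
  ∩-elim {E} {F} {a} {b} e = ∧-conicalˡ (E a b) (F a b) e , ∧-conicalʳ (E a b) (F a b) e

  single-intro : ∀ a b → Edge (single a b) a b
  single-intro a b = ∧-intro (⌊⌋-intro (a ≟ a) refl) (⌊⌋-intro (b ≟ b) refl)

  single-elim : ∀ a b {x y} → Edge (single a b) x y → x ≡ a × y ≡ b
  single-elim a b {x} {y} e =
    ⌊⌋-elim (x ≟ a) (∧-conicalˡ _ _ e) , ⌊⌋-elim (y ≟ b) (∧-conicalʳ ⌊ x ≟ a ⌋ _ e)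

  loopless⇒irreflexive : ∀ {E} → Loopless E → Irreflexive E
  loopless⇒irreflexive loopless a e with trans (sym e) (loopless a)
  ... | ()

  irreflexive⇒distinct : ∀ {E a b} → Irreflexive E → Edge E a b → a ≢ b
  irreflexive⇒distinct irr e refl = irr _ e

  oriented⇒distinct : ∀ {O : EdgeSet n} {a b} → Oriented O → Edge O a b → a ≢ b
  oriented⇒distinct oriented e refl = oriented _ _ e e

  undirected⇒symmetric : ∀ {E} → Undirected E → Symmetric E
  undirected⇒symmetric undirected {a} {b} e = trans (sym (undirected a b)) e

  _∖𝒰_ : EdgeSet n → EdgeSet n → EdgeSet n
  (G ∖𝒰 R) a b = G a b ∧ not (R a b ∨ R b a)

  module _ {G R : EdgeSet n} where

    ∖𝒰-intro : ∀ {a b} → Edge G a b → ¬ Edge R a b → ¬ Edge R b a → Edge (G ∖𝒰 R) a b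
    ∖𝒰-intro {a} {b} g ¬ab ¬ba =
      ∧-intro g (not-intro λ e → [ ¬ab , ¬ba ]′ (∨-elim (R a b) e))

    ∖𝒰-⊆ : ∀ {a b} → Edge (G ∖𝒰 R) a b → Edge G a b
    ∖𝒰-⊆ {a} {b} e = ∧-conicalˡ (G a b) _ e

    ∖𝒰-avoids : ∀ {a b} → Edge (G ∖𝒰 R) a b → ¬ Edge R a b × ¬ Edge R b a
    ∖𝒰-avoids {a} {b} e =
      (λ r → none (∨-introˡ (R b a) r)) , (λ r → none (∨-introʳ (R a b) r))
      where none = not-elim (∧-conicalʳ (G a b) _ e)

    ∖𝒰-removed : ∀ {a b} → Edge G a b → ¬ Edge (G ∖𝒰 R) a b → Edge R a b ⊎ Edge R b a
    ∖𝒰-removed {a} {b} g ¬e with edge? R a b | edge? R b a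
    ... | yes r | _     = inj₁ r
    ... | no _  | yes r = inj₂ r
    ... | no ¬ab | no ¬ba = ⊥-elim (¬e (∖𝒰-intro g ¬ab ¬ba))

    ∖𝒰-undirected : Undirected G → Undirected (G ∖𝒰 R)
    ∖𝒰-undirected undirected a b = cong₂ _∧_ (undirected a b) (cong not (∨-comm (R a b) (R b a)))

  -- the complete graph; complement E unfolds to complete ∖𝒰 E
  complete : EdgeSet n
  complete a b = not ⌊ a ≟ b ⌋

  complement-distinct : ∀ {E a b} → Edge (complement E) a b → a ≢ b
  complement-distinct {E} {a} {b} e a≡b =
    not-elim (∖𝒰-⊆ {complete} {E} e) (⌊⌋-intro (a ≟ b) a≡b)

  complement-avoids : ∀ {E a b} → Edge (complement E) a b → ¬ Edge E a b × ¬ Edge E b a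
  complement-avoids {E} = ∖𝒰-avoids {complete} {E}

  complement-intro : ∀ {E a b} → a ≢ b → ¬ Edge E a b → ¬ Edge E b a → Edge (complement E) a b
  complement-intro {E} {a} {b} a≢b =
    ∖𝒰-intro {complete} {E} (not-intro λ e → a≢b (⌊⌋-elim (a ≟ b) e))

  complement-irreflexive : ∀ {E} → Irreflexive (complement E)
  complement-irreflexive {E} a e = complement-distinct {E} e refl

  complement-symmetric : ∀ {E} → Symmetric (complement E)
  complement-symmetric {E} e =
    complement-intro {E} (λ b≡a → complement-distinct {E} e (sym b≡a))
      (proj₂ (complement-avoids {E} e)) (proj₁ (complement-avoids {E} e))

  complement-antitone : ∀ {E F} → E ⊆ F → complement F ⊆ complement E
  complement-antitone {E} {F} E⊆F a b e =
    complement-intro {E} (complement-distinct {F} e)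
      (λ x → proj₁ (complement-avoids {F} e) (E⊆F a b x))
      (λ x → proj₂ (complement-avoids {F} e) (E⊆F b a x))

  -- An orientation of an irreflexive graph keeps every edge in some direction:
  -- otherwise the missing edge could be added, contradicting maximality.
  orientation-covers : ∀ {O E} → IsOrientation O E → Irreflexive E → Covers O E
  orientation-covers {O} {E} (O⊆E , oriented , maximal) irr {a} {b} eab
    with edge? O a b | edge? O b a
  ... | yes oab | _       = inj₁ oab
  ... | no _    | yes oba = inj₂ oba
  ... | no ¬oab | no ¬oba =
    ⊥-elim (¬oab (maximal O⁺ (λ _ _ → ∨-introˡ _) O⁺⊆E O⁺-oriented a b
                          (∨-introʳ (O a b) (single-intro a b))))
    where
    O⁺ : EdgeSet n
    O⁺ = O ∪ single a b

    O⁺⊆E : O⁺ ⊆ E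
    O⁺⊆E x y e with ∨-elim (O x y) e
    ... | inj₁ o = O⊆E x y o
    ... | inj₂ s with single-elim a b {x} {y} s
    ...   | refl , refl = eab

    O⁺-oriented : Oriented O⁺
    O⁺-oriented x y e e' with ∨-elim (O x y) e | ∨-elim (O y x) e'
    ... | inj₁ o | inj₁ o' = oriented x y o o'
    ... | inj₁ o | inj₂ s with single-elim a b {y} {x} s
    ...   | refl , refl = ¬oba o
    O⁺-oriented x y e e' | inj₂ s | inj₁ o' with single-elim a b {x} {y} s
    ...   | refl , refl = ¬oba o'
    O⁺-oriented x y e e' | inj₂ s | inj₂ s'
      with single-elim a b {x} {y} s | single-elim a b {y} {x} s'
    ...   | refl , refl | refl , _ = irr a eab

  covering-orientation : ∀ {O E} → O ⊆ E → Oriented O → Covers O E → IsOrientation O E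
  covering-orientation O⊆E oriented covers =
    O⊆E , oriented , λ O' O⊆O' O'⊆E oriented' x y o' →
      [ (λ o → o) , (λ o → ⊥-elim (oriented' x y o' (O⊆O' y x o))) ]′ (covers (O'⊆E x y o'))

  restrict-orientation : ∀ {O E F} → IsOrientation O E → Irreflexive E → F ⊆ E → Symmetric F →
    IsOrientation (O ∩ F) F
  restrict-orientation {O} {F = F} O-orient irr F⊆E F-sym =
    covering-orientation (λ a b e → proj₂ (∩-elim {O} {F} e))
      (λ a b e e' → proj₁ (proj₂ O-orient) a b (proj₁ (∩-elim {O} {F} e)) (proj₁ (∩-elim {O} {F} e')))
      λ {a} {b} f → ⊎-map (λ o → ∩-intro {O} {F} o f) (λ o → ∩-intro {O} {F} o (F-sym f))
                                  (orientation-covers O-orient irr (F⊆E a b f))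

  reverse-orientation : ∀ {O E} → IsOrientation O E → Irreflexive E → Symmetric E →
    IsOrientation (inverse O) E
  reverse-orientation O-orient@(O⊆E , oriented , _) irr E-sym =
    covering-orientation (λ a b o → E-sym (O⊆E b a o)) (λ a b o o' → oriented a b o' o)
      λ e → ⊎-swap (orientation-covers O-orient irr e)

  reverse-transitive : ∀ {O : EdgeSet n} → Transitive O → Transitive (inverse O)
  reverse-transitive trans-O a b c o o' a≢c = trans-O c b a o' o λ c≡a → a≢c (sym c≡a)

  tieBreak : EdgeSet n → EdgeSet n
  tieBreak R a b = R a b ∧ (not (R b a) ∨ ⌊ a <? b ⌋)

  module _ {R : EdgeSet n} where

    tieBreak-one-way : ∀ {a b} → Edge R a b → ¬ Edge R b a → Edge (tieBreak R) a b
    tieBreak-one-way r ¬r = ∧-intro r (∨-introˡ _ (not-intro ¬r))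

    tieBreak-increasing : ∀ {a b} → Edge R a b → a < b → Edge (tieBreak R) a b
    tieBreak-increasing {a} {b} r a<b = ∧-intro r (∨-introʳ (not (R b a)) (⌊⌋-intro (a <? b) a<b))

    tieBreak-⊆ : ∀ {a b} → Edge (tieBreak R) a b → Edge R a b
    tieBreak-⊆ {a} {b} t = ∧-conicalˡ (R a b) _ t

    tieBreak-order : ∀ {a b} → Edge (tieBreak R) a b → Edge R b a → a < b
    tieBreak-order {a} {b} t r with ∨-elim (not (R b a)) (∧-conicalʳ (R a b) _ t)
    ... | inj₁ one-way    = ⊥-elim (not-elim one-way r)
    ... | inj₂ increasing = ⌊⌋-elim (a <? b) increasing

    tieBreak-covers : Irreflexive R → Covers (tieBreak R) R
    tieBreak-covers irr {a} {b} r with edge? R b a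
    ... | no ¬r = inj₁ (tieBreak-one-way r ¬r)
    ... | yes r' with <-cmp a b
    ...   | tri< a<b _ _ = inj₁ (tieBreak-increasing r a<b)
    ...   | tri≈ _ a≡b _ = ⊥-elim (irreflexive⇒distinct irr r a≡b)
    ...   | tri> _ _ b<a = inj₂ (tieBreak-increasing r' b<a)

    tieBreak-transitive : Irreflexive R → Transitive R → Transitive (tieBreak R)
    tieBreak-transitive irr R-trans x y z t t' x≢z with edge? R z x
    ... | no ¬rzx = tieBreak-one-way rxz ¬rzx
      where rxz = R-trans x y z (tieBreak-⊆ t) (tieBreak-⊆ t') x≢z
    ... | yes rzx = tieBreak-increasing rxz (<-trans (tieBreak-order t ryx) (tieBreak-order t' rzy))
      where
      rxy = tieBreak-⊆ t
      ryz = tieBreak-⊆ t'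
      rxz = R-trans x y z rxy ryz x≢z
      ryx = R-trans y z x ryz rzx λ y≡x → irreflexive⇒distinct irr rxy (sym y≡x)
      rzy = R-trans z x y rzx rxy λ z≡y → irreflexive⇒distinct irr ryz (sym z≡y)

  tieBreak-orientation : ∀ {R F} → Irreflexive R → Transitive R → R ⊆ F → Covers R F →
    TransitivelyOrientable F
  tieBreak-orientation {R} {F} irr R-trans R⊆F R-covers =
    tieBreak R ,
    covering-orientation (λ a b t → R⊆F a b (tieBreak-⊆ {R} t)) oriented
      (λ f → [ tieBreak-covers {R} irr , (λ r → ⊎-swap (tieBreak-covers {R} irr r)) ]′ (R-covers f)) ,
    tieBreak-transitive {R} irr R-trans
    where
    oriented : Oriented (tieBreak R)
    oriented a b t t' =
      <-asym (tieBreak-order {R} t (tieBreak-⊆ {R} t')) (tieBreak-order {R} t' (tieBreak-⊆ {R} t))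

  module _ (H : EdgeSet n) where

    open DecMembership (_≟_ {n}) using (_∈?_)

    infixr 5 _◅_ _◅◅_

    data Walk : Fin n → Fin n → ℕ → Set where
      ε   : ∀ {a} → Walk a a 0
      _◅_ : ∀ {a b c k} → Edge H a b → Walk b c k → Walk a c (suc k)

    _◅◅_ : ∀ {a b c i j} → Walk a b i → Walk b c j → Walk a c (i + j)
    ε       ◅◅ w' = w'
    (h ◅ w) ◅◅ w' = h ◅ (w ◅◅ w')

    walk⇒closure : ∀ {a c k} → a ≢ c → Walk a c k → Closure H a c
    walk⇒closure a≢c ε = ⊥-elim (a≢c refl)
    walk⇒closure {c = c} a≢c (_◅_ {b = b} h w) with b ≟ c
    ... | yes refl = base h
    ... | no b≢c   = step (base h) (walk⇒closure b≢c w) a≢c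

    closure⇒walk : ∀ {a c} → Closure H a c → ∃ (Walk a c)
    closure⇒walk (base h) = 1 , h ◅ ε
    closure⇒walk (step p q _) = _ , proj₂ (closure⇒walk p) ◅◅ proj₂ (closure⇒walk q)

    closure-loop : ∀ {a} → Closure H a a → Edge H a a
    closure-loop (base h)     = h
    closure-loop (step _ _ a≢a) = ⊥-elim (a≢a refl)

    vertices : ∀ {a c k} → Walk a c k → Vec (Fin n) (suc k)
    vertices {a} ε       = a ∷ []
    vertices {a} (_ ◅ w) = a ∷ vertices w

    suffix : ∀ {a c k v} (w : Walk a c k) → v ∈ vertices w → ∃ λ j → j ≤ℕ k × Walk v c j
    suffix ε       (here refl) = 0 , ≤-refl , ε
    suffix (h ◅ w) (here refl) = _ , ≤-refl , h ◅ w
    suffix (h ◅ w) (there v∈w) =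
      let (j , j≤k , w') = suffix w v∈w in j , m≤n⇒m≤1+n j≤k , w'

    shortcut : ∀ {a c k} (w : Walk a c k) → (∃ λ j → j <ℕ k × Walk a c j) ⊎ Unique (vertices w)
    shortcut ε = inj₂ ([] ∷ [])
    shortcut {a} (h ◅ w) with shortcut w
    ... | inj₁ (j , j<k , w') = inj₁ (suc j , s≤s j<k , h ◅ w')
    ... | inj₂ distinct with a ∈? vertices w
    ...   | yes a∈w = let (j , j≤k , w') = suffix w a∈w in inj₁ (j , s≤s j≤k , w')
    ...   | no a∉w  = inj₂ (∉⇒All≢ (vertices w) a∉w ∷ distinct)

    ShortWalk : Fin n → Fin n → Set
    ShortWalk a c = ∃ λ j → j <ℕ n × Walk a c j

    short-walk : ∀ {a c k} → Walk a c k → ShortWalk a c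
    short-walk {k = k} = <-rec (λ k → ∀ {a c} → Walk a c k → ShortWalk a c) by-shortcut k
      where
      by-shortcut : ∀ k → (∀ {j} → j <ℕ k → ∀ {a c} → Walk a c j → ShortWalk a c) →
                    ∀ {a c} → Walk a c k → ShortWalk a c
      by-shortcut k shorter w with shortcut w
      ... | inj₁ (j , j<k , w') = shorter j<k w'
      ... | inj₂ distinct       = k , unique-length (vertices w) distinct , w

    walk? : ∀ k a c → Dec (Walk a c k)
    walk? zero a c = map′ (λ { refl → ε }) (λ { ε → refl }) (a ≟ c)
    walk? (suc k) a c =
      map′ (λ (b , h , w) → h ◅ w) (λ { (h ◅ w) → _ , h , w })
           (any? λ b → edge? H a b ×-dec walk? k b c)

    -- H* is decidable: it suffices to search the short walks
    closure? : ∀ a c → Dec (Closure H a c)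
    closure? a c with a ≟ c
    ... | yes refl = map′ base closure-loop (edge? H a a)
    ... | no a≢c   =
      map′ (λ (_ , _ , w) → walk⇒closure a≢c w) (λ cl → short-walk (proj₂ (closure⇒walk cl)))
           (anyUpTo? (λ k → walk? k a c) n)

  closure : EdgeSet n → EdgeSet n
  closure H a b = ⌊ closure? H a b ⌋

  module _ {H : EdgeSet n} where

    closure-complete : ∀ {a b} → Closure H a b → Edge (closure H) a b
    closure-complete {a} {b} = ⌊⌋-intro (closure? H a b)

    closure-sound : ∀ {a b} → Edge (closure H) a b → Closure H a b
    closure-sound {a} {b} = ⌊⌋-elim (closure? H a b)

    closure-transitive : Transitive (closure H)
    closure-transitive a b c e e' a≢c = closure-complete (step (closure-sound e) (closure-sound e') a≢c)

    closure-irreflexive : Irreflexive H → Irreflexive (closure H)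
    closure-irreflexive irr a e = irr a (closure-loop H (closure-sound e))

    closure-least : ∀ {R a b} → H ⊆ R → Transitive R → Closure H a b → Edge R a b
    closure-least H⊆R R-trans (base h)       = H⊆R _ _ h
    closure-least H⊆R R-trans (step p q a≢c) =
      R-trans _ _ _ (closure-least H⊆R R-trans p) (closure-least H⊆R R-trans q) a≢c

module RemovalOfClosure {n : ℕ} {G T H : EdgeSet n}
  (G-irr : Irreflexive G) (G-undirected : Undirected G)
  (T-orient : IsOrientation T G) (T-trans : Transitive T)
  (H-orient : IsOrientation H (complement G)) where

  G-sym : Symmetric G
  G-sym = undirected⇒symmetric G-undirected

  H⊆Ḡ : H ⊆ complement G
  H⊆Ḡ = proj₁ H-orient

  H-oriented : Oriented H
  H-oriented = proj₁ (proj₂ H-orient)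

  H-irr : Irreflexive H
  H-irr a h = oriented⇒distinct H-oriented h refl

  H-covers : Covers H (complement G)
  H-covers = orientation-covers H-orient (complement-irreflexive {E = G})

  Ḡ-covered : ∀ {a b} → a ≢ b → ¬ Edge G a b → Edge H a b ⊎ Edge H b a
  Ḡ-covered a≢b ¬g = H-covers (complement-intro {E = G} a≢b ¬g (λ g → ¬g (G-sym g)))

  P : EdgeSet n
  P = G ∖𝒰 closure H

  P-intro : ∀ {a b} → Edge G a b → ¬ Edge (closure H) a b → ¬ Edge (closure H) b a → Edge P a b
  P-intro = ∖𝒰-intro {G = G} {R = closure H}

  P⊆G : P ⊆ G
  P⊆G _ _ = ∖𝒰-⊆ {G = G} {R = closure H}

  P-undirected : Undirected P
  P-undirected = ∖𝒰-undirected {G = G} {R = closure H} G-undirected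

  P-avoids : ∀ {a b} → Edge P a b → ¬ Closure H a b × ¬ Closure H b a
  P-avoids p =
    (λ c → proj₁ (∖𝒰-avoids {G = G} {R = closure H} p) (closure-complete c)) ,
    (λ c → proj₂ (∖𝒰-avoids {G = G} {R = closure H} p) (closure-complete c))

  P-removal : IsRemoval P G H
  P-removal a b =
    (λ p → P⊆G a b p , [ proj₁ (P-avoids p) , proj₂ (P-avoids p) ]′) ,
    (λ (g , ¬C) → P-intro g (λ c → ¬C (inj₁ (closure-sound c))) (λ c → ¬C (inj₂ (closure-sound c))))

  -- If neither x ⇝ b nor b ⇝ c in H*, there is no H-walk from x to c: its
  -- next vertex y ≠ b satisfies y → b in R (keeping the invariant), since
  -- b → y would give x → y ∈ R ⊆ G against xy ∈ H ⊆ Ḡ, and yb ∉ G would put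
  -- y → b or b → y into H, creating x ⇝ b or b ⇝ c.
  no-shortcut : ∀ {R} → IsOrientation R G → Transitive R →
    ∀ {x b c k} → Walk H x c k → Edge R x b → Edge R b c → ¬ Closure H x b → ¬ Closure H b c → ⊥
  no-shortcut (_ , R-oriented , _) _ ε rcb rbc _ _ = R-oriented _ _ rcb rbc
  no-shortcut {R} R-orient@(R⊆G , R-oriented , _) R-trans {x} {b} (_◅_ {b = y} hxy w)
              rxb rbc ¬x⇝b ¬b⇝c
    with y ≟ b | edge? G y b
  ... | yes refl | _ = ¬x⇝b (base hxy)
  ... | no y≢b | yes gyb = [ onward , backward ]′ (orientation-covers R-orient G-irr gyb)
    where
    onward : Edge R y b → ⊥
    onward ryb = no-shortcut R-orient R-trans w ryb rbc
                   (λ y⇝b → ¬x⇝b (step (base hxy) y⇝b (oriented⇒distinct R-oriented rxb))) ¬b⇝c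
    backward : Edge R b y → ⊥
    backward rby = proj₁ (complement-avoids {E = G} (H⊆Ḡ _ _ hxy))
                         (R⊆G _ _ (R-trans x b y rxb rby (oriented⇒distinct H-oriented hxy)))
  ... | no y≢b | no ¬gyb = [ into-b , out-of-b ]′ (Ḡ-covered y≢b ¬gyb)
    where
    into-b : Edge H y b → ⊥
    into-b hyb = ¬x⇝b (step (base hxy) (base hyb) (oriented⇒distinct R-oriented rxb))
    out-of-b : Edge H b y → ⊥
    out-of-b hby = ¬b⇝c (walk⇒closure H (oriented⇒distinct R-oriented rbc) (hby ◅ w))

  P-transitive-step : ∀ {a b c} → Edge T a b → Edge T b c → Edge P a b → Edge P b c → a ≢ c → Edge P a c
  P-transitive-step {a} {b} {c} tab tbc pab pbc a≢c =
    P-intro (proj₁ T-orient _ _ (T-trans a b c tab tbc a≢c)) ¬a⇝c ¬c⇝a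
    where
    ¬a⇝c : ¬ Edge (closure H) a c
    ¬a⇝c e = no-shortcut T-orient T-trans (proj₂ (closure⇒walk H (closure-sound e)))
               tab tbc (proj₁ (P-avoids pab)) (proj₁ (P-avoids pbc))
    ¬c⇝a : ¬ Edge (closure H) c a
    ¬c⇝a e = no-shortcut (reverse-orientation T-orient G-irr G-sym) (reverse-transitive T-trans)
               (proj₂ (closure⇒walk H (closure-sound e)))
               tbc tab (proj₂ (P-avoids pbc)) (proj₂ (P-avoids pab))

  P-transitively-orientable : TransitivelyOrientable P
  P-transitively-orientable =
    T ∩ P ,
    restrict-orientation T-orient G-irr P⊆G (undirected⇒symmetric P-undirected) ,
    λ a b c e e' a≢c →
      let (tab , pab) = ∩-elim {E = T} {F = P} e ; (tbc , pbc) = ∩-elim {E = T} {F = P} e'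
      in ∩-intro {E = T} {F = P} (T-trans a b c tab tbc a≢c) (P-transitive-step tab tbc pab pbc a≢c)

  closure⊆P̄ : closure H ⊆ complement P
  closure⊆P̄ a b e =
    complement-intro {E = P} (irreflexive⇒distinct (closure-irreflexive H-irr) e)
      (λ p → proj₁ (P-avoids p) (closure-sound e)) (λ p → proj₂ (P-avoids p) (closure-sound e))

  P̄-covered : Covers (closure H) (complement P)
  P̄-covered {a} {b} e with edge? G a b
  ... | yes g  = ∖𝒰-removed {G = G} {R = closure H} g (proj₁ (complement-avoids {E = P} e))
  ... | no ¬g = ⊎-map (λ h → closure-complete (base h)) (λ h → closure-complete (base h))
                      (Ḡ-covered (complement-distinct {E = P} e) ¬g)

  permutation-subgraph : PermutationSubgraph P G
  permutation-subgraph =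
    P⊆G , P-undirected , P-transitively-orientable ,
    tieBreak-orientation (closure-irreflexive H-irr) closure-transitive closure⊆P̄ P̄-covered

-- Part (ii): a locally maximal permutation subgraph P₀, with C a transitive
-- orientation of its complement, equals G ∖ 𝒰(H*) for H = C ∩ Ḡ, because
-- H* ⊆ C avoids P₀ and so P₀ ⊆ G ∖ 𝒰(H*).
locally-maximal-removal : ∀ {n} {G T P₀ : EdgeSet n} → Irreflexive G → Undirected G →
  IsOrientation T G → Transitive T → LocallyMaximal P₀ G →
  Σ (EdgeSet n) λ H → IsOrientation H (complement G) × IsRemoval P₀ G H
locally-maximal-removal {n} {G} {T} {P₀} G-irr G-undirected T-orient T-trans
  ((P₀⊆G , _ , _ , C , C-orient , C-trans) , maximal) =
  H , H-orient ,
  λ a b → (λ p₀ → proj₁ (P-removal a b) (P₀⊆P a b p₀)) , (λ r → P⊆P₀ a b (proj₂ (P-removal a b) r))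
  where
  H : EdgeSet n
  H = C ∩ complement G

  H-orient : IsOrientation H (complement G)
  H-orient = restrict-orientation C-orient (complement-irreflexive {E = P₀})
               (complement-antitone P₀⊆G) (complement-symmetric {E = G})

  open RemovalOfClosure G-irr G-undirected T-orient T-trans H-orient

  H⊆C : H ⊆ C
  H⊆C _ _ h = proj₁ (∩-elim {E = C} {F = complement G} h)

  -- H* ⊆ C ⊆ P̄₀
  closure-avoids-P₀ : ∀ {a b} → Edge (closure H) a b → ¬ Edge P₀ a b × ¬ Edge P₀ b a
  closure-avoids-P₀ e =
    complement-avoids {E = P₀} (proj₁ C-orient _ _ (closure-least H⊆C C-trans (closure-sound e)))

  P₀⊆P : P₀ ⊆ P
  P₀⊆P a b p₀ =
    P-intro (P₀⊆G a b p₀) (λ e → proj₁ (closure-avoids-P₀ e) p₀) (λ e → proj₂ (closure-avoids-P₀ e) p₀)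

  P⊆P₀ : P ⊆ P₀
  P⊆P₀ = maximal P permutation-subgraph P₀⊆P

corollary14 : (n : ℕ) (G : EdgeSet n) →
    Loopless G → Undirected G → TransitivelyOrientable G →
    ((H : EdgeSet n) → IsOrientation H (complement G) →
       Σ (EdgeSet n) λ P → IsRemoval P G H × PermutationSubgraph P G)
    ×
    ((P : EdgeSet n) → LocallyMaximal P G →
       Σ (EdgeSet n) λ H → IsOrientation H (complement G) × IsRemoval P G H)
corollary14 n G G-loopless G-undirected (T , T-orient , T-trans) =
  (λ H H-orient →
     let open RemovalOfClosure G-irr G-undirected T-orient T-trans H-orient
     in P , P-removal , permutation-subgraph) ,
  (λ P₀ P₀-maximal → locally-maximal-removal G-irr G-undirected T-orient T-trans P₀-maximal)
  where
  G-irr : Irreflexive G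
  G-irr = loopless⇒irreflexive {E = G} G-loopless
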